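{- Let $G=(V,E,\mathsf{w})$ be a vertex-weighted graph with $\mathsf{w}\colon V\to\mathbb{Z}^{+}$ that has a universal vertex $u$ (a vertex adjacent to every other vertex). Then $\mathrm{wvi}(G)=\mathrm{wvi}(G-u)+\mathsf{w}(u)$.
   Context: $\mathrm{wvi}(G)=\min_{S\subseteq V}\{\mathsf{w}(S)+\max_{C\in\mathrm{cc}(G-S)}\mathsf{w}(V(C))\}$, where $\mathsf{w}(X)=\sum_{v\in X}\mathsf{w}(v)$, $\mathrm{cc}(G-S)$ is the set of connected components of $G-S$, and a maximum over the empty set is $0$; $G-u$ carries the restricted weight function. -}

module Defs where

open import Data.Nat using (ℕ; zero; suc; _+_; _≤_; _<_)
open import Data.Fin using (Fin; punchIn)
open import Data.Bool using (Bool; true; false; if_then_else_; _∧_; not)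
open import Data.List using (List; map)
open import Data.Nat.ListAction using (sum)
open import Data.List using () renaming (allFin to allFinL)
open import Data.Product using (Σ; ∃; _×_; _,_)
open import Data.Sum using (_⊎_)
open import Relation.Binary.PropositionalEquality using (_≡_)
open import Relation.Nullary using (¬_)

record Graph (n : ℕ) : Set where
  field
    adj   : Fin n → Fin n → Bool
    sym   : ∀ x y → adj x y ≡ adj y x
    irrefl : ∀ x → adj x x ≡ false
open Graph public

Subset : ℕ → Set
Subset n = Fin n → Bool

_∈ₛ_ : ∀ {n} → Fin n → Subset n → Set
x ∈ₛ S = S x ≡ true

wt : ∀ {n} → (Fin n → ℕ) → Subset n → ℕ
wt {n} w X = sum (map (λ v → if X v then w v else 0) (allFinL n))

data PathIn {n} (G : Graph n) (C : Subset n) : Fin n → Fin n → Set where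
  here : ∀ {x} → x ∈ₛ C → PathIn G C x x
  step : ∀ {x y z} → x ∈ₛ C → adj G x y ≡ true → PathIn G C y z → PathIn G C x z

IsComponent : ∀ {n} → Graph n → Subset n → Subset n → Set
IsComponent {n} G S C =
  (∃ λ x → x ∈ₛ C)
  × (∀ x → x ∈ₛ C → S x ≡ false)
  × (∀ x y → x ∈ₛ C → y ∈ₛ C → PathIn G C x y)
  × (∀ x y → x ∈ₛ C → adj G x y ≡ true → S y ≡ false → y ∈ₛ C)

-- m = max_{C ∈ cc(G - S)} w(V(C)), with max over the empty family being 0.
IsMaxCompWeight : ∀ {n} → Graph n → (Fin n → ℕ) → Subset n → ℕ → Set
IsMaxCompWeight G w S m =
  (∀ C → IsComponent G S C → wt w C ≤ m)
  × (m ≡ 0 ⊎ Σ _ λ C → IsComponent G S C × wt w C ≡ m)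

IsCost : ∀ {n} → Graph n → (Fin n → ℕ) → Subset n → ℕ → Set
IsCost G w S c = Σ ℕ λ m → IsMaxCompWeight G w S m × c ≡ wt w S + m

IsWvi : ∀ {n} → Graph n → (Fin n → ℕ) → ℕ → Set
IsWvi {n} G w k =
  (Σ (Subset n) λ S → IsCost G w S k)
  × (∀ S c → IsCost G w S c → k ≤ c)

PositiveWeight : ∀ {n} → (Fin n → ℕ) → Set
PositiveWeight w = ∀ v → 0 < w v

Universal : ∀ {n} → Graph n → Fin n → Set
Universal G u = ∀ v → ¬ (v ≡ u) → adj G u v ≡ true

deleteV : ∀ {n} → Graph (suc n) → Fin (suc n) → Graph n
deleteV G u = record
  { adj = λ x y → adj G (punchIn u x) (punchIn u y)
  ; sym = λ x y → sym G (punchIn u x) (punchIn u y)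
  ; irrefl = λ x → irrefl G (punchIn u x) }

deleteW : ∀ {n} → (Fin (suc n) → ℕ) → Fin (suc n) → (Fin n → ℕ)
deleteW w u x = w (punchIn u x)

-- A separator S containing the universal vertex u corresponds to the separator S - u of
-- G - u: the components of G - S are exactly those of (G - u) - (S - u), so the cost
-- of S is the cost of S - u plus w(u).  A separator S avoiding u leaves the single
-- component V - S (every vertex is adjacent to u), so it costs w(V) = w(V - u) + w(u),
-- which is at least wvi(G - u) + w(u) because V - u is itself a separator of G - u.
{-# OPTIONS --safe #-}
module Submission where

open import Defs hiding (sym)
open import Data.Nat using (ℕ; suc; _+_)
open import Data.Fin using (Fin)
open import Data.Product using (Σ; _×_)

open import Data.Nat using (zero; _≤_; _<_; z≤n; s≤s)
open import Data.Nat.Properties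
  using (≤-refl; ≤-trans; ≤-reflexive; ≤-antisym; <-≤-trans; <⇒≱; <⇒≤; ≰⇒>; _≤?_;
         +-comm; +-assoc; +-suc; +-identityʳ; +-mono-≤; +-monoˡ-≤; +-monoʳ-≤; m≤n+m; m<n+m;
         +-0-commutativeMonoid; module ≤-Reasoning)
open import Algebra.Properties.CommutativeMonoid.Sum +-0-commutativeMonoid
  using (sum-remove; ∑-distrib-+; sum-cong-≗) renaming (sum to ∑)
open import Data.Fin using (zero; suc; punchIn; punchOut)
open import Data.Fin.Properties
  using (any?; punchIn-injective; punchIn-punchOut) renaming (_≟_ to _≟ᶠ_)
open import Data.Bool using (Bool; true; false; if_then_else_; not)
open import Data.Bool.Properties using (¬-not; not-injective) renaming (_≟_ to _≟ᵇ_)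
open import Data.Vec using (Vec; []; _∷_; lookup)
import Data.Vec as Vec
open import Data.Vec.Properties using (lookup∘tabulate)
open import Data.Vec.Functional using (removeAt; insertAt)
open import Data.Vec.Functional.Properties using (insertAt-lookup; insertAt-punchIn; removeAt-insertAt)
import Data.List as List
open import Data.List.Properties using (map-tabulate)
open import Data.Nat.ListAction using () renaming (sum to sumᴸ)
open import Data.List.Extrema.Nat using (max; xs≤max; argmax-sel)
import Data.List.Relation.Unary.All as All
open import Data.List.Membership.Propositional.Properties using (∈-map⁺; ∈-map⁻; ∈-allFin)
open import Data.Product using (∃; _,_; proj₁; proj₂; map₂)
open import Data.Sum using (_⊎_; inj₁; inj₂)
import Data.Sum as Sum
open import Function using (_∘_; id)
open import Relation.Nullary using (Dec; yes; no; does; contradiction)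
open import Relation.Nullary.Decidable using (_×-dec_; dec-true)
open import Relation.Binary.PropositionalEquality
  using (_≡_; _≗_; refl; sym; trans; cong; cong₂; subst; module ≡-Reasoning)

infix 4 _⊆_
_⊆_ : ∀ {n} → Subset n → Subset n → Set
X ⊆ Y = ∀ {x} → x ∈ₛ X → x ∈ₛ Y

everything : ∀ {n} → Subset n
everything _ = true

⁅_⁆ : ∀ {n} → Fin n → Subset n
⁅ x ⁆ y = does (x ≟ᶠ y)

weightIn : ∀ {n} → (Fin n → ℕ) → Subset n → Fin n → ℕ
weightIn w X v = if X v then w v else 0

sum-tabulate : ∀ {n} (f : Fin n → ℕ) → sumᴸ (List.tabulate f) ≡ ∑ f
sum-tabulate {zero}  f = refl
sum-tabulate {suc n} f = cong (f zero +_) (sum-tabulate (f ∘ suc))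

wt≡∑ : ∀ {n} (w : Fin n → ℕ) X → wt w X ≡ ∑ (weightIn w X)
wt≡∑ w X = trans (cong sumᴸ (map-tabulate id (weightIn w X))) (sum-tabulate (weightIn w X))

∑-mono-≤ : ∀ {n} {f g : Fin n → ℕ} → (∀ i → f i ≤ g i) → ∑ f ≤ ∑ g
∑-mono-≤ {zero}  _   = z≤n
∑-mono-≤ {suc n} f≤g = +-mono-≤ (f≤g zero) (∑-mono-≤ (f≤g ∘ suc))

wt-cong : ∀ {n} (w : Fin n → ℕ) {X Y} → X ≗ Y → wt w X ≡ wt w Y
wt-cong w {X} {Y} X≗Y = begin
  wt w X             ≡⟨ wt≡∑ w X ⟩
  ∑ (weightIn w X)   ≡⟨ sum-cong-≗ (λ i → cong (λ b → if b then w i else 0) (X≗Y i)) ⟩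
  ∑ (weightIn w Y)   ≡⟨ wt≡∑ w Y ⟨
  wt w Y             ∎
  where open ≡-Reasoning

wt-mono : ∀ {n} (w : Fin n → ℕ) {X Y} → X ⊆ Y → wt w X ≤ wt w Y
wt-mono w {X} {Y} X⊆Y rewrite wt≡∑ w X | wt≡∑ w Y = ∑-mono-≤ pointwise
  where
  pointwise : ∀ i → weightIn w X i ≤ weightIn w Y i
  pointwise i with X i in i∈X
  ... | false = z≤n
  ... | true rewrite X⊆Y i∈X = ≤-refl

wt-removeAt : ∀ {n} (w : Fin (suc n) → ℕ) X u →
              wt w X ≡ (if X u then w u else 0) + wt (removeAt w u) (removeAt X u)
wt-removeAt w X u = begin
  wt w X                                          ≡⟨ wt≡∑ w X ⟩
  ∑ (weightIn w X)                                ≡⟨ sum-remove {i = u} (weightIn w X) ⟩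
  weightIn w X u + ∑ (removeAt (weightIn w X) u)
    ≡⟨ cong (weightIn w X u +_) (wt≡∑ (removeAt w u) (removeAt X u)) ⟨
  weightIn w X u + wt (removeAt w u) (removeAt X u) ∎
  where open ≡-Reasoning

wt-removeAt-∈ : ∀ {n} (w : Fin (suc n) → ℕ) {X u} → u ∈ₛ X →
                wt w X ≡ w u + wt (removeAt w u) (removeAt X u)
wt-removeAt-∈ w {X} {u} u∈X rewrite wt-removeAt w X u | u∈X = refl

wt-removeAt-∉ : ∀ {n} (w : Fin (suc n) → ℕ) {X u} → X u ≡ false →
                wt w X ≡ wt (removeAt w u) (removeAt X u)
wt-removeAt-∉ w {X} {u} u∉X rewrite wt-removeAt w X u | u∉X = refl

wt-< : ∀ {n} (w : Fin n → ℕ) {X Y y} → X ⊆ Y → y ∈ₛ Y → X y ≡ false → 0 < w y →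
       wt w X < wt w Y
wt-< {suc n} w {X} {Y} {y} X⊆Y y∈Y y∉X 0<wy = begin-strict
  wt w X                              ≡⟨ wt-removeAt-∉ w y∉X ⟩
  wt (removeAt w y) (removeAt X y)    ≤⟨ wt-mono (removeAt w y) X⊆Y ⟩
  wt (removeAt w y) (removeAt Y y)    <⟨ m<n+m _ 0<wy ⟩
  w y + wt (removeAt w y) (removeAt Y y) ≡⟨ wt-removeAt-∈ w y∈Y ⟨
  wt w Y                              ∎
  where open ≤-Reasoning

wt-complement : ∀ {n} (w : Fin n → ℕ) X → wt w X + wt w (not ∘ X) ≡ wt w everything
wt-complement w X = begin
  wt w X + wt w (not ∘ X)                            ≡⟨ cong₂ _+_ (wt≡∑ w X) (wt≡∑ w (not ∘ X)) ⟩
  ∑ (weightIn w X) + ∑ (weightIn w (not ∘ X))        ≡⟨ ∑-distrib-+ (weightIn w X) _ ⟨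
  ∑ (λ i → weightIn w X i + weightIn w (not ∘ X) i)  ≡⟨ sum-cong-≗ split ⟩
  ∑ (weightIn w everything)                          ≡⟨ wt≡∑ w everything ⟨
  wt w everything                                    ∎
  where
  open ≡-Reasoning
  split : ∀ i → weightIn w X i + weightIn w (not ∘ X) i ≡ w i
  split i with X i
  ... | true  = +-identityʳ (w i)
  ... | false = refl

-- Saturating an inflationary operator on vertex sets

module _ {n} (F : Subset n → Subset n) (F-inflationary : ∀ R → R ⊆ F R) where

  private
    size : Subset n → ℕ
    size = wt (λ _ → 1)

    closed-or-grows : ∀ T → F T ⊆ T ⊎ size T < size (F T)
    closed-or-grows T with any? (λ y → (F T y ≟ᵇ true) ×-dec (T y ≟ᵇ false))
    ... | yes (y , y∈FT , y∉T) =
      inj₂ (wt-< (λ _ → 1) {T} {F T} (F-inflationary T) y∈FT y∉T (s≤s z≤n))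
    ... | no none              = inj₁ λ {y} y∈FT → ¬-not (λ y∉T → none (y , y∈FT , y∉T))

  -- Each non-closed step adds a vertex, so the size of the set is a termination measure.
  saturate : (P : Subset n → Set) → (∀ {T} → P T → P (F T)) →
             ∀ {T} → P T → Σ (Subset n) λ T → F T ⊆ T × P T
  saturate P preserved {T} PT = go (suc (size everything)) (m≤n+m _ (size T)) PT
    where
    go : ∀ fuel {T} → size everything < size T + fuel → P T → Σ (Subset n) λ T → F T ⊆ T × P T
    go zero {T} small _ =
      contradiction (wt-mono (λ _ → 1) {T} {everything} (λ _ → refl))
                    (<⇒≱ (subst (_ <_) (+-identityʳ (size T)) small))
    go (suc fuel) {T} small PT with closed-or-grows T
    ... | inj₁ closed = T , closed , PT
    ... | inj₂ grows  = go fuel (<-≤-trans small larger) (preserved PT)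
      where
      larger : size T + suc fuel ≤ size (F T) + fuel
      larger = subst (_≤ size (F T) + fuel) (sym (+-suc (size T) fuel)) (+-monoˡ-≤ fuel grows)

PathIn-source : ∀ {n} {G : Graph n} {C x y} → PathIn G C x y → x ∈ₛ C
PathIn-source (here x∈C)     = x∈C
PathIn-source (step x∈C _ _) = x∈C

PathIn-++ : ∀ {n} {G : Graph n} {C x y z} → PathIn G C x y → PathIn G C y z → PathIn G C x z
PathIn-++ (here _)         q = q
PathIn-++ (step x∈C x~y p) q = step x∈C x~y (PathIn-++ p q)

PathIn-reverse : ∀ {n} {G : Graph n} {C x y} → PathIn G C x y → PathIn G C y x
PathIn-reverse         (here x∈C)       = here x∈C
PathIn-reverse {G = G} (step x∈C x~y p) =
  PathIn-++ (PathIn-reverse p) (step (PathIn-source p) (trans (Graph.sym G _ _) x~y) (here x∈C))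

PathIn-mono : ∀ {n} {G : Graph n} {C D x y} → C ⊆ D → PathIn G C x y → PathIn G D x y
PathIn-mono C⊆D (here x∈C)       = here (C⊆D x∈C)
PathIn-mono C⊆D (step x∈C x~y p) = step (C⊆D x∈C) x~y (PathIn-mono C⊆D p)

module _ {n} {G : Graph n} {S : Subset n} where

  ∉-component : ∀ {C x} → IsComponent G S C → x ∈ₛ S → C x ≡ false
  ∉-component (_ , disjoint , _) x∈S =
    ¬-not λ x∈C → contradiction (trans (sym x∈S) (disjoint _ x∈C)) λ ()

  component-⊆ : ∀ {C D x} → IsComponent G S C → IsComponent G S D → x ∈ₛ C → x ∈ₛ D → C ⊆ D
  component-⊆ {C} {D} (_ , disjoint , connected , _) (_ , _ , _ , closed) x∈C x∈D y∈C =
    walk (connected _ _ x∈C y∈C) x∈D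
    where
    walk : ∀ {a b} → PathIn G C a b → a ∈ₛ D → b ∈ₛ D
    walk (here _)       a∈D = a∈D
    walk (step _ a~c p) a∈D = walk p (closed _ _ a∈D a~c (disjoint _ (PathIn-source p)))

  component-cong : ∀ {T C} → S ≗ T → IsComponent G S C → IsComponent G T C
  component-cong S≗T (nonempty , disjoint , connected , closed) =
    nonempty , (λ x x∈C → trans (sym (S≗T x)) (disjoint x x∈C)) , connected ,
    (λ x y x∈C x~y y∉T → closed x y x∈C x~y (trans (S≗T y) y∉T))

module Reachability {n} (G : Graph n) (S : Subset n) where

  Frontier : Subset n → Fin n → Set
  Frontier R y = S y ≡ false × ∃ λ z → z ∈ₛ R × adj G z y ≡ true

  frontier? : ∀ R y → Dec (Frontier R y)
  frontier? R y = (S y ≟ᵇ false) ×-dec any? (λ z → (R z ≟ᵇ true) ×-dec (adj G z y ≟ᵇ true))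

  expand : Subset n → Subset n
  expand R y with frontier? R y
  ... | yes _ = true
  ... | no _  = R y

  expand-inflationary : ∀ R → R ⊆ expand R
  expand-inflationary R {y} y∈R with frontier? R y
  ... | yes _ = refl
  ... | no _  = y∈R

  frontier⊆expand : ∀ {R y} → Frontier R y → y ∈ₛ expand R
  frontier⊆expand {R} {y} fr with frontier? R y
  ... | yes _  = refl
  ... | no ¬fr = contradiction fr ¬fr

  expand-cases : ∀ {R y} → y ∈ₛ expand R → y ∈ₛ R ⊎ Frontier R y
  expand-cases {R} {y} y∈ with frontier? R y
  ... | yes fr = inj₂ fr
  ... | no _   = inj₁ y∈

  ReachedFrom : Fin n → Subset n → Set
  ReachedFrom x R = x ∈ₛ R × (∀ {y} → y ∈ₛ R → S y ≡ false × PathIn G R x y)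

  reachedFrom-⁅⁆ : ∀ {x} → S x ≡ false → ReachedFrom x ⁅ x ⁆
  reachedFrom-⁅⁆ {x} x∉S = dec-true (x ≟ᶠ x) refl , reach
    where
    reach : ∀ {y} → y ∈ₛ ⁅ x ⁆ → S y ≡ false × PathIn G ⁅ x ⁆ x y
    reach {y} y∈ with x ≟ᶠ y
    ... | yes refl = x∉S , here (dec-true (x ≟ᶠ x) refl)

  reachedFrom-expand : ∀ {x R} → ReachedFrom x R → ReachedFrom x (expand R)
  reachedFrom-expand {x} {R} (x∈R , reach) = expand-inflationary R x∈R , reach′
    where
    lift : ∀ {a b} → PathIn G R a b → PathIn G (expand R) a b
    lift = PathIn-mono (expand-inflationary R)
    reach′ : ∀ {y} → y ∈ₛ expand R → S y ≡ false × PathIn G (expand R) x y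
    reach′ y∈ with expand-cases y∈
    ... | inj₁ y∈R                 = map₂ lift (reach y∈R)
    ... | inj₂ (y∉S , z , z∈R , z~y) =
      y∉S , PathIn-++ (lift (proj₂ (reach z∈R))) (step (expand-inflationary R z∈R) z~y (here y∈))

  componentOf : ∀ x → S x ≡ false → Σ (Subset n) λ C → x ∈ₛ C × IsComponent G S C
  componentOf x x∉S
    with saturate expand expand-inflationary (ReachedFrom x) reachedFrom-expand (reachedFrom-⁅⁆ x∉S)
  ... | C , closed , x∈C , reach =
    C , x∈C , (x , x∈C) , (λ y y∈C → proj₁ (reach y∈C)) ,
    (λ y z y∈C z∈C → PathIn-++ (PathIn-reverse (proj₂ (reach y∈C))) (proj₂ (reach z∈C))) ,
    (λ y z y∈C y~z z∉S → closed (frontier⊆expand (z∉S , y , y∈C , y~z)))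

maximum : ∀ {n} (f : Fin n → ℕ) → Σ ℕ λ M → (∀ i → f i ≤ M) × (M ≡ 0 ⊎ ∃ λ i → f i ≡ M)
maximum {n} f = max 0 values , bound , attained
  where
  values = List.map f (List.allFin n)
  bound : ∀ i → f i ≤ max 0 values
  bound i = All.lookup (xs≤max 0 values) (∈-map⁺ f (∈-allFin i))
  attained : max 0 values ≡ 0 ⊎ ∃ λ i → f i ≡ max 0 values
  attained with argmax-sel id 0 values
  ... | inj₁ M≡0 = inj₁ M≡0
  ... | inj₂ M∈  with ∈-map⁻ f M∈
  ...   | i , _ , M≡fi = inj₂ (i , sym M≡fi)

module _ {n} (G : Graph n) (w : Fin n → ℕ) (S : Subset n) where

  private
    open Reachability G S

    candidate : Fin n → ℕ
    candidate x with S x ≟ᵇ false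
    ... | yes x∉S = wt w (proj₁ (componentOf x x∉S))
    ... | no _    = 0

    component≤candidate : ∀ {C x} → IsComponent G S C → x ∈ₛ C → wt w C ≤ candidate x
    component≤candidate {C} {x} C-comp@(_ , disjoint , _) x∈C with S x ≟ᵇ false
    ... | yes x∉S = let (D , x∈D , D-comp) = componentOf x x∉S in
                    wt-mono w (component-⊆ C-comp D-comp x∈C x∈D)
    ... | no ¬x∉S = contradiction (disjoint x x∈C) ¬x∉S

    candidate-attained : ∀ x →
      candidate x ≡ 0 ⊎ Σ (Subset n) λ C → IsComponent G S C × wt w C ≡ candidate x
    candidate-attained x with S x ≟ᵇ false
    ... | yes x∉S = let (D , _ , D-comp) = componentOf x x∉S in inj₂ (D , D-comp , refl)
    ... | no _    = inj₁ refl

  maxCompWeight : Σ ℕ (IsMaxCompWeight G w S)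
  maxCompWeight with maximum candidate
  ... | M , bound , attained = M , bounded , attained′ attained
    where
    bounded : ∀ C → IsComponent G S C → wt w C ≤ M
    bounded C C-comp@((x , x∈C) , _) = ≤-trans (component≤candidate C-comp x∈C) (bound x)
    attained′ : (M ≡ 0 ⊎ ∃ λ i → candidate i ≡ M) →
                M ≡ 0 ⊎ Σ (Subset n) λ C → IsComponent G S C × wt w C ≡ M
    attained′ (inj₁ M≡0)       = inj₁ M≡0
    attained′ (inj₂ (i , i≡M)) with candidate-attained i
    ... | inj₁ i≡0                = inj₁ (trans (sym i≡M) i≡0)
    ... | inj₂ (C , C-comp , C≡i) = inj₂ (C , C-comp , trans C≡i i≡M)

cost : ∀ {n} → Graph n → (Fin n → ℕ) → Subset n → ℕ
cost G w S = wt w S + proj₁ (maxCompWeight G w S)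

cost-isCost : ∀ {n} (G : Graph n) w S → IsCost G w S (cost G w S)
cost-isCost G w S = proj₁ (maxCompWeight G w S) , proj₂ (maxCompWeight G w S) , refl

module _ {n} {G : Graph n} {w : Fin n → ℕ} where

  isMaxCompWeight-unique : ∀ {S m m′} → IsMaxCompWeight G w S m → IsMaxCompWeight G w S m′ → m ≡ m′
  isMaxCompWeight-unique {S} (bound , attained) (bound′ , attained′) =
    ≤-antisym (below attained bound′) (below attained′ bound)
    where
    below : ∀ {a b} → (a ≡ 0 ⊎ Σ (Subset n) λ C → IsComponent G S C × wt w C ≡ a) →
            (∀ C → IsComponent G S C → wt w C ≤ b) → a ≤ b
    below (inj₁ refl)                _     = z≤n
    below (inj₂ (C , C-comp , refl)) bound = bound C C-comp

  isCost-unique : ∀ {S c c′} → IsCost G w S c → IsCost G w S c′ → c ≡ c′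
  isCost-unique {S} (m , m-max , c≡) (m′ , m′-max , c′≡) =
    trans c≡ (trans (cong (wt w S +_) (isMaxCompWeight-unique m-max m′-max)) (sym c′≡))

  isMaxCompWeight-cong : ∀ {S T m} → S ≗ T → IsMaxCompWeight G w S m → IsMaxCompWeight G w T m
  isMaxCompWeight-cong S≗T (bound , attained) =
    (λ C C-comp → bound C (component-cong (sym ∘ S≗T) C-comp)) ,
    Sum.map₂ (λ (C , C-comp , C≡m) → C , component-cong S≗T C-comp , C≡m) attained

  isCost-cong : ∀ {S T c} → S ≗ T → IsCost G w S c → IsCost G w T c
  isCost-cong S≗T (m , m-max , c≡) =
    m , isMaxCompWeight-cong S≗T m-max , trans c≡ (cong (_+ m) (wt-cong w S≗T))

  isCost-everything : IsCost G w everything (wt w everything)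
  isCost-everything =
    0 , ((λ C ((x , x∈C) , disjoint , _) → contradiction (disjoint x x∈C) λ ()) , inj₁ refl) ,
    sym (+-identityʳ _)

cost-cong : ∀ {n} (G : Graph n) w {S T} → S ≗ T → cost G w S ≡ cost G w T
cost-cong G w {S} {T} S≗T = isCost-unique (isCost-cong S≗T (cost-isCost G w S)) (cost-isCost G w T)

-- Existence of wvi

argmin-Vec : ∀ {n} (h : Vec Bool n → ℕ) → Σ (Vec Bool n) λ v₀ → ∀ v → h v₀ ≤ h v
argmin-Vec {zero}  h = [] , λ { [] → ≤-refl }
argmin-Vec {suc n} h
  with argmin-Vec (λ v → h (true ∷ v)) | argmin-Vec (λ v → h (false ∷ v))
... | a , a-min | b , b-min with h (true ∷ a) ≤? h (false ∷ b)
... | yes a≤b = true ∷ a ,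
  λ { (true ∷ v) → a-min v ; (false ∷ v) → ≤-trans a≤b (b-min v) }
... | no  a≰b = false ∷ b ,
  λ { (true ∷ v) → ≤-trans (<⇒≤ (≰⇒> a≰b)) (a-min v) ; (false ∷ v) → b-min v }

argmin-Subset : ∀ {n} (h : Subset n → ℕ) → (∀ {S T} → S ≗ T → h S ≡ h T) →
                Σ (Subset n) λ S₀ → ∀ S → h S₀ ≤ h S
argmin-Subset h h-cong with argmin-Vec (h ∘ lookup)
... | v₀ , v₀-min =
  lookup v₀ , λ S → ≤-trans (v₀-min (Vec.tabulate S)) (≤-reflexive (h-cong (lookup∘tabulate S)))

wvi-exists : ∀ {n} (G : Graph n) (w : Fin n → ℕ) → Σ ℕ (IsWvi G w)
wvi-exists G w with argmin-Subset (cost G w) (cost-cong G w)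
... | S₀ , S₀-min =
  cost G w S₀ , (S₀ , cost-isCost G w S₀) ,
  λ S c S-cost → ≤-trans (S₀-min S) (≤-reflexive (isCost-unique (cost-isCost G w S) S-cost))

-- Deleting a vertex

punchIn-view : ∀ {n} (u x : Fin (suc n)) → x ≡ u ⊎ ∃ λ i → x ≡ punchIn u i
punchIn-view u x with u ≟ᶠ x
... | yes refl = inj₁ refl
... | no u≢x   = inj₂ (punchOut u≢x , sym (punchIn-punchOut u≢x))

module Deletion {n} (G : Graph (suc n)) (u : Fin (suc n)) where

  G⁻ : Graph n
  G⁻ = deleteV G u

  PathIn-punchIn : ∀ {C i j} b → PathIn G⁻ C i j →
                   PathIn G (insertAt C u b) (punchIn u i) (punchIn u j)
  PathIn-punchIn {C} b (here {i} i∈C) = here (trans (insertAt-punchIn C u b i) i∈C)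
  PathIn-punchIn {C} b (step {i} i∈C i~j p) =
    step (trans (insertAt-punchIn C u b i) i∈C) i~j (PathIn-punchIn b p)

  PathIn-removeAt : ∀ {C x y i j} → C u ≡ false → PathIn G C x y →
                    x ≡ punchIn u i → y ≡ punchIn u j → PathIn G⁻ (removeAt C u) i j
  PathIn-removeAt {i = i} {j} _ (here x∈C) refl y≡ =
    subst (PathIn G⁻ _ i) (punchIn-injective u i j y≡) (here x∈C)
  PathIn-removeAt u∉C (step {y = v} x∈C x~v p) refl y≡ with punchIn-view u v
  ... | inj₁ refl      = contradiction (trans (sym (PathIn-source p)) u∉C) λ ()
  ... | inj₂ (k , refl) = step x∈C x~v (PathIn-removeAt u∉C p refl y≡)

  component-removeAt : ∀ {S C} → u ∈ₛ S → IsComponent G S C →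
                       IsComponent G⁻ (removeAt S u) (removeAt C u)
  component-removeAt {S} {C} u∈S C-comp@((x , x∈C) , disjoint , connected , closed) =
    nonempty , (λ i → disjoint (punchIn u i)) ,
    (λ i j i∈C j∈C → PathIn-removeAt u∉C (connected _ _ i∈C j∈C) refl refl) ,
    (λ i j → closed (punchIn u i) (punchIn u j))
    where
    u∉C = ∉-component C-comp u∈S
    nonempty : ∃ λ i → removeAt C u i ≡ true
    nonempty with punchIn-view u x
    ... | inj₁ refl      = contradiction (trans (sym x∈C) u∉C) λ ()
    ... | inj₂ (i , refl) = i , x∈C

  component-insertAt : ∀ {S C} → u ∈ₛ S → IsComponent G⁻ (removeAt S u) C →
                       IsComponent G S (insertAt C u false)
  component-insertAt {S} {C} u∈S ((i , i∈C) , disjoint , connected , closed) =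
    (punchIn u i , lift i∈C) , disjoint′ , connected′ , closed′
    where
    C⁺ = insertAt C u false
    lift : ∀ {i} → i ∈ₛ C → punchIn u i ∈ₛ C⁺
    lift {i} = trans (insertAt-punchIn C u false i)
    unlift : ∀ {i} → punchIn u i ∈ₛ C⁺ → i ∈ₛ C
    unlift {i} = trans (sym (insertAt-punchIn C u false i))
    member : ∀ {x} → x ∈ₛ C⁺ → ∃ λ i → x ≡ punchIn u i
    member {x} x∈ with punchIn-view u x
    ... | inj₁ refl = contradiction (trans (sym x∈) (insertAt-lookup C u false)) λ ()
    ... | inj₂ x≡   = x≡
    disjoint′ : ∀ x → x ∈ₛ C⁺ → S x ≡ false
    disjoint′ x x∈ with member x∈
    ... | i , refl = disjoint i (unlift x∈)
    connected′ : ∀ x y → x ∈ₛ C⁺ → y ∈ₛ C⁺ → PathIn G C⁺ x y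
    connected′ x y x∈ y∈ with member x∈ | member y∈
    ... | i , refl | j , refl = PathIn-punchIn false (connected i j (unlift x∈) (unlift y∈))
    closed′ : ∀ x y → x ∈ₛ C⁺ → adj G x y ≡ true → S y ≡ false → y ∈ₛ C⁺
    closed′ x y x∈ x~y y∉S with member x∈ | punchIn-view u y
    ... | _        | inj₁ refl       = contradiction (trans (sym u∈S) y∉S) λ ()
    ... | i , refl | inj₂ (j , refl) = lift (closed i j (unlift x∈) x~y y∉S)

  module _ (w : Fin (suc n) → ℕ) where

    private
      w⁻ : Fin n → ℕ
      w⁻ = deleteW w u

    wt-insertAt-false : ∀ C → wt w (insertAt C u false) ≡ wt w⁻ C
    wt-insertAt-false C =
      trans (wt-removeAt-∉ w (insertAt-lookup C u false)) (wt-cong w⁻ (removeAt-insertAt C u false))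

    isMaxCompWeight-deleteV : ∀ {S m} → u ∈ₛ S →
      IsMaxCompWeight G⁻ w⁻ (removeAt S u) m → IsMaxCompWeight G w S m
    isMaxCompWeight-deleteV {S} {m} u∈S (bound , attained) =
      (λ C C-comp → subst (_≤ m) (sym (wt-removeAt-∉ w (∉-component C-comp u∈S)))
                           (bound _ (component-removeAt u∈S C-comp))) ,
      Sum.map₂ (λ (C , C-comp , C≡m) →
                  insertAt C u false , component-insertAt u∈S C-comp , trans (wt-insertAt-false C) C≡m)
               attained

    isCost-deleteV : ∀ {S c} → u ∈ₛ S → IsCost G⁻ w⁻ (removeAt S u) c → IsCost G w S (c + w u)
    isCost-deleteV {S} {c} u∈S (m , m-max , c≡) = m , isMaxCompWeight-deleteV u∈S m-max , c+wu≡
      where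
      open ≡-Reasoning
      S⁻ = removeAt S u
      c+wu≡ : c + w u ≡ wt w S + m
      c+wu≡ = begin
        c + w u              ≡⟨ cong (_+ w u) c≡ ⟩
        wt w⁻ S⁻ + m + w u   ≡⟨ +-comm (wt w⁻ S⁻ + m) (w u) ⟩
        w u + (wt w⁻ S⁻ + m) ≡⟨ +-assoc (w u) (wt w⁻ S⁻) m ⟨
        w u + wt w⁻ S⁻ + m   ≡⟨ cong (_+ m) (wt-removeAt-∈ w u∈S) ⟨
        wt w S + m           ∎

-- A universal vertex

module _ {n} {G : Graph n} {u : Fin n} (universal : Universal G u) where

  complement-isComponent : ∀ {S} → S u ≡ false → IsComponent G S (not ∘ S)
  complement-isComponent {S} u∉S =
    (u , cong not u∉S) , (λ x → not-injective) ,
    (λ x y x∈ y∈ → PathIn-++ (toU x x∈) (PathIn-reverse (toU y y∈))) ,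
    (λ x y _ _ y∉S → cong not y∉S)
    where
    toU : ∀ x → x ∈ₛ (not ∘ S) → PathIn G (not ∘ S) x u
    toU x x∈ with x ≟ᶠ u
    ... | yes refl = here x∈
    ... | no x≢u   = step x∈ (trans (Graph.sym G x u) (universal x x≢u)) (here (cong not u∉S))

  total≤cost : ∀ {w S c} → S u ≡ false → IsCost G w S c → wt w everything ≤ c
  total≤cost {w} {S} {c} u∉S (m , (bound , _) , c≡) = begin
    wt w everything          ≡⟨ wt-complement w S ⟨
    wt w S + wt w (not ∘ S)  ≤⟨ +-monoʳ-≤ (wt w S) (bound _ (complement-isComponent u∉S)) ⟩
    wt w S + m               ≡⟨ c≡ ⟨
    c                        ∎
    where open ≤-Reasoning

lemma4p1 : (n : ℕ) (G : Graph (suc n)) (w : Fin (suc n) → ℕ) (u : Fin (suc n)) →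
    PositiveWeight w → Universal G u →
    Σ ℕ λ k → IsWvi (deleteV G u) (deleteW w u) k × IsWvi G w (k + w u)
lemma4p1 n G w u _ universal with wvi-exists (deleteV G u) (deleteW w u)
... | k , k-wvi@((S⁻ , S⁻-cost) , k-min) = k , k-wvi , (insertAt S⁻ u true , lifted) , optimal
  where
  open Deletion G u
  w⁻ : Fin n → ℕ
  w⁻ = deleteW w u
  lifted : IsCost G w (insertAt S⁻ u true) (k + w u)
  lifted = isCost-deleteV w (insertAt-lookup S⁻ u true)
                            (isCost-cong (sym ∘ removeAt-insertAt S⁻ u true) S⁻-cost)
  optimal : ∀ S c → IsCost G w S c → k + w u ≤ c
  optimal S c S-cost with S u in Su
  ... | true  = begin
    k + w u                         ≤⟨ +-monoˡ-≤ (w u) (k-min _ _ (cost-isCost G⁻ w⁻ (removeAt S u))) ⟩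
    cost G⁻ w⁻ (removeAt S u) + w u ≡⟨ isCost-unique (isCost-deleteV w Su (cost-isCost _ _ _)) S-cost ⟩
    c                               ∎
    where open ≤-Reasoning
  ... | false = begin
    k + w u                   ≤⟨ +-monoˡ-≤ (w u) (k-min everything _ isCost-everything) ⟩
    wt w⁻ everything + w u    ≡⟨ +-comm _ (w u) ⟩
    w u + wt w⁻ everything    ≡⟨ wt-removeAt-∈ w refl ⟨
    wt w everything           ≤⟨ total≤cost universal Su S-cost ⟩
    c                         ∎
    where open ≤-Reasoning
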